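{- Let $p$ be a prime and let $A,B\subseteq\mathbb{Z}/p\mathbb{Z}$ with $|A|\ge 5$, $|B|\ge 2$, $p\ge |A|+|B|$, and $|A\widehat{+}B|=|A|+|B|-3$. If there exist $\tau,d\in\mathbb{Z}/p\mathbb{Z}$ with $d\neq 0$ such that $A=\{\tau+id: i=0,1,\dots,|A|-1\}$, then $A=B$ (so $(A,B)$ is a standard pair: $A=B$ is such an arithmetic progression).
   Context: For $A,B\subseteq\mathbb{Z}/p\mathbb{Z}$, the restricted sumset is $A\widehat{+}B=\{a+b \bmod p: a\in A,\ b\in B,\ a\neq b\}$. A set of the form $\{\tau+id: i=0,\dots,|A|-1\}$ with $d\neq0$ is a standard set; $(A,B)$ is a standard pair if $A=B$ and both are standard sets. -}

module Defs where

open import Data.Nat using (ℕ; _+_; _*_; _<_; NonZero)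
open import Data.Nat.DivMod using (_mod_)
open import Data.Fin using (Fin; toℕ)
open import Data.Fin.Subset using (Subset; _∈_)
open import Data.Fin.Properties using (any?)
open import Data.Product using (Σ; ∃; _×_; _,_)
open import Relation.Nullary using (¬_; Dec; yes; no)
open import Relation.Nullary.Decidable using (_×-dec_; ¬?)
open import Relation.Binary.PropositionalEquality using (_≡_)
open import Data.Bool using (Bool; true; false)
open import Data.Vec using (tabulate)
import Data.Fin.Subset.Properties as SP
import Data.Fin.Properties as FP

-- Elements of ℤ/pℤ are represented by Fin p; addition is mod p.
_+ₚ_ : ∀ {p} .{{_ : NonZero p}} → Fin p → Fin p → Fin p
a +ₚ b = (toℕ a + toℕ b) mod _

InRestrSum : ∀ {p} .{{_ : NonZero p}} → Subset p → Subset p → Fin p → Set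
InRestrSum A B c = ∃ λ a → ∃ λ b → a ∈ A × b ∈ B × ¬ (a ≡ b) × c ≡ a +ₚ b

InRestrSum? : ∀ {p} .{{_ : NonZero p}} (A B : Subset p) (c : Fin p) → Dec (InRestrSum A B c)
InRestrSum? A B c =
  any? λ a → any? λ b →
    SP._∈?_ a A ×-dec (SP._∈?_ b B ×-dec (¬? (a FP.≟ b) ×-dec (c FP.≟ (a +ₚ b))))

decToBool : ∀ {P : Set} → Dec P → Bool
decToBool (yes _) = true
decToBool (no _) = false

_+̂_ : ∀ {p} .{{_ : NonZero p}} → Subset p → Subset p → Subset p
A +̂ B = tabulate λ c → decToBool (InRestrSum? A B c)

IsAP : ∀ {p} .{{_ : NonZero p}} → Subset p → Fin p → Fin p → ℕ → Set
IsAP {p} A τ d k = ∀ x → (x ∈ A → ∃ λ i → i < k × x ≡ (toℕ τ + i * toℕ d) mod p)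
                       × ((∃ λ i → i < k × x ≡ (toℕ τ + i * toℕ d) mod p) → x ∈ A)

-- Transport along the affine bijection j ↦ τ + j d, which maps [0, k) onto A (k = |A|), a set β
-- onto B, and [0, k) +̂ β injectively into A +̂ B. It then suffices that |[0, k) +̂ β| ≥ k + |β| - 2
-- unless β = [0, k).
-- If every residue lies in the ordinary sumset [0, k) + β, the restricted sumset only misses doubles
-- 2b of "lonely" b ∈ β, and two lonely x < y satisfy 2x < y and x + k ≤ 2y, so there are at most two.
-- Otherwise rotate an uncovered residue to just below 0: then β lies in an interval on which no sum
-- wraps around p. With u and w the least and greatest elements of β, the chains
-- u + [0, k - 1) ∪ (β + (k - 1)) and β ∪ (w + [1, k)) consist of k + |β| - 1 distinct sums, of which
-- the restriction removes at most one from each part. If both chains lose an element from both parts,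
-- then β ⊆ [0, k) with 0, k - 1 ∈ β, and [1, 2k - 3] ⊆ [0, k) +̂ β.
module Submission where

open import Data.Bool using (true; false)
open import Data.Empty using (⊥; ⊥-elim)
open import Data.Fin as Fin using (Fin; zero; suc; toℕ; fromℕ<; punchIn)
import Data.Fin.Properties as Finₚ
open import Data.Fin.Properties using (toℕ<n; toℕ-injective; toℕ-fromℕ<)
open import Data.Fin.Subset using (Subset; ∣_∣; _∈_; _∉_; ∁; Nonempty)
import Data.Fin.Subset.Properties as Subsetₚ
open import Data.Nat
  using (ℕ; zero; suc; _+_; _*_; _∸_; _≤_; _<_; _≥_; z≤n; s≤s; NonZero; >-nonZero⁻¹; _≤?_; _<?_; _≟_)
open import Data.Nat.DivMod
open import Data.Nat.Divisibility using (_∣_; m%n≡0⇒n∣m; n∣m⇒m%n≡0)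
open import Data.Nat.Primality using (Prime; euclidsLemma)
open import Data.Nat.Properties
open import Data.Nat.Solver using (module +-*-Solver)
open import Data.Product using (∃; _×_; _,_; proj₁; proj₂)
open import Data.Sum using (_⊎_; inj₁; inj₂; fromInj₁)
open import Data.Vec using (_∷_; here; there; tabulate)
open import Data.Vec.Properties using (lookup∘tabulate; []=⇒lookup; lookup⇒[]=)
open import Function.Base using (_∘_)
open import Function.Bundles using (Equivalence; _⇔_; mk⇔; Injection)
open import Function.Definitions using (Injective)
open import Function.Properties.Inverse using (↔⇒↣)
open import Relation.Nullary using (¬_; Dec; yes; no)
open import Relation.Nullary.Decidable using (_×-dec_; _⊎-dec_; ¬?; decidable-stable)
open import Relation.Unary using (Pred; Decidable)
open import Relation.Binary.PropositionalEquality
open import Algebra.Properties.CommutativeSemigroup +-commutativeSemigroup using (x∙yz≈y∙xz)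

open import Defs

open Equivalence

⟪_⟫ : ∀ {n} {P : Pred (Fin n) _} → Decidable P → Subset n
⟪ P? ⟫ = tabulate λ x → decToBool (P? x)

∈⟪⟫⇔ : ∀ {n} {P : Pred (Fin n) _} (P? : Decidable P) {x} → x ∈ ⟪ P? ⟫ ⇔ P x
∈⟪⟫⇔ P? {x} = mk⇔ (λ x∈ → true⇒P (P? x) (trans (sym (lookup∘tabulate _ x)) ([]=⇒lookup x∈)))
                  (λ Px → lookup⇒[]= x _ (trans (lookup∘tabulate _ x) (P⇒true (P? x) Px)))
  where
  true⇒P : ∀ {Q : Set} (Q? : Dec Q) → decToBool Q? ≡ true → Q
  true⇒P (yes q) _ = q
  P⇒true : ∀ {Q : Set} (Q? : Dec Q) → Q → decToBool Q? ≡ true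
  P⇒true (yes _) _ = refl
  P⇒true (no ¬q) q = ⊥-elim (¬q q)

elemAt : ∀ {n} (S : Subset n) → Fin ∣ S ∣ → Fin n
elemAt (true ∷ S) zero = zero
elemAt (true ∷ S) (suc i) = suc (elemAt S i)
elemAt (false ∷ S) i = suc (elemAt S i)

elemAt-∈ : ∀ {n} (S : Subset n) i → elemAt S i ∈ S
elemAt-∈ (true ∷ S) zero = here
elemAt-∈ (true ∷ S) (suc i) = there (elemAt-∈ S i)
elemAt-∈ (false ∷ S) i = there (elemAt-∈ S i)

elemAt-strictMono : ∀ {n} (S : Subset n) {i j} → i Fin.< j → elemAt S i Fin.< elemAt S j
elemAt-strictMono (true ∷ S) {zero} {suc j} _ = s≤s z≤n
elemAt-strictMono (true ∷ S) {suc i} {suc j} (s≤s i<j) = s≤s (elemAt-strictMono S i<j)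
elemAt-strictMono (false ∷ S) i<j = s≤s (elemAt-strictMono S i<j)

elemAt-injective : ∀ {n} (S : Subset n) → Injective _≡_ _≡_ (elemAt S)
elemAt-injective (true ∷ S) {zero} {zero} _ = refl
elemAt-injective (true ∷ S) {suc i} {suc j} eq = cong suc (elemAt-injective S (Finₚ.suc-injective eq))
elemAt-injective (false ∷ S) eq = elemAt-injective S (Finₚ.suc-injective eq)

rank : ∀ {n} (S : Subset n) {x} → x ∈ S → Fin ∣ S ∣
rank (true ∷ S) here = zero
rank (true ∷ S) (there x∈S) = suc (rank S x∈S)
rank (false ∷ S) (there x∈S) = rank S x∈S

rank-injective : ∀ {n} (S : Subset n) {x y} (x∈S : x ∈ S) (y∈S : y ∈ S) → rank S x∈S ≡ rank S y∈S → x ≡ y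
rank-injective (true ∷ S) here here _ = refl
rank-injective (true ∷ S) (there x∈S) (there y∈S) eq = cong suc (rank-injective S x∈S y∈S (Finₚ.suc-injective eq))
rank-injective (false ∷ S) (there x∈S) (there y∈S) eq = cong suc (rank-injective S x∈S y∈S eq)

injective⇒≤∣p∣ : ∀ {m n} (S : Subset n) {f : Fin m → Fin n}
  → Injective _≡_ _≡_ f → (∀ i → f i ∈ S) → m ≤ ∣ S ∣
injective⇒≤∣p∣ S f-inj f∈S = Finₚ.injective⇒≤ λ eq → f-inj (rank-injective S (f∈S _) (f∈S _) eq)

injectsInto⇒∣p∣≤∣q∣ : ∀ {m n} (S : Subset m) (S′ : Subset n) (f : Fin m → Fin n)
  → (∀ {x y} → x ∈ S → y ∈ S → f x ≡ f y → x ≡ y) → (∀ {x} → x ∈ S → f x ∈ S′)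
  → ∣ S ∣ ≤ ∣ S′ ∣
injectsInto⇒∣p∣≤∣q∣ S S′ f f-inj f∈S′ = injective⇒≤∣p∣ S′
  (λ eq → elemAt-injective S (f-inj (elemAt-∈ S _) (elemAt-∈ S _) eq)) (λ i → f∈S′ (elemAt-∈ S i))

injective-allButOne⇒∸1≤∣p∣ : ∀ {m n} (S : Subset n) {f : Fin m → Fin n} → Injective _≡_ _≡_ f
  → (∀ i j → f i ∉ S → f j ∉ S → i ≡ j) → m ∸ 1 ≤ ∣ S ∣
injective-allButOne⇒∸1≤∣p∣ {zero} S f-inj atMostOne = z≤n
injective-allButOne⇒∸1≤∣p∣ {suc m} S {f} f-inj atMostOne with Finₚ.any? (λ i → ¬? (f i Subsetₚ.∈? S))
... | no noneOut = ≤-trans (n≤1+n m) (injective⇒≤∣p∣ S f-inj λ i →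
  decidable-stable (f i Subsetₚ.∈? S) (λ fi∉S → noneOut (i , fi∉S)))
... | yes (i₀ , fi₀∉S) = injective⇒≤∣p∣ S (λ eq → Finₚ.punchIn-injective i₀ _ _ (f-inj eq)) inS
  where
  inS : ∀ j → f (punchIn i₀ j) ∈ S
  inS j = decidable-stable (_ Subsetₚ.∈? S) λ out → Finₚ.punchInᵢ≢i i₀ j (atMostOne _ _ out fi₀∉S)

injective⊎-allButOne⇒∸1≤∣p∣ : ∀ {m m′ n} (S : Subset n) {f : Fin m ⊎ Fin m′ → Fin n} → Injective _≡_ _≡_ f
  → (∀ i j → f i ∉ S → f j ∉ S → i ≡ j) → m + m′ ∸ 1 ≤ ∣ S ∣
injective⊎-allButOne⇒∸1≤∣p∣ S f-inj atMostOne =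
  injective-allButOne⇒∸1≤∣p∣ S (λ eq → splitAt-injective (f-inj eq))
    λ i j i∉ j∉ → splitAt-injective (atMostOne _ _ i∉ j∉)
  where splitAt-injective = Injection.injective (↔⇒↣ Finₚ.+↔⊎)

injective⇒surjective : ∀ {n} {f : Fin n → Fin n} → Injective _≡_ _≡_ f → ∀ y → ∃ λ x → f x ≡ y
injective⇒surjective {suc n} {f} f-inj y with Finₚ.any? (λ x → f x Finₚ.≟ y)
... | yes hit = hit
... | no miss = ⊥-elim (1+n≰n (Finₚ.injective⇒≤ λ eq → f-inj (Finₚ.punchOut-injective (y≢f _) (y≢f _) eq)))
  where
  y≢f : ∀ x → y ≢ f x
  y≢f x y≡fx = miss (x , sym y≡fx)

least : ∀ {n} (S : Subset n) → Nonempty S → ∃ λ u → u ∈ S × (∀ {y} → y ∈ S → u Fin.≤ y)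
least (true ∷ S) _ = zero , here , λ _ → z≤n
least (false ∷ S) (suc x , there x∈S) with least S (x , x∈S)
... | u , u∈S , u≤ = suc u , there u∈S , λ { (there y∈S) → s≤s (u≤ y∈S) }

greatest : ∀ {n} (S : Subset n) → Nonempty S → ∃ λ w → w ∈ S × (∀ {y} → y ∈ S → y Fin.≤ w)
greatest (s ∷ S) x∈S with Subsetₚ.nonempty? S
... | yes ne with greatest S ne
...   | w , w∈S , ≤w = suc w , there w∈S , λ { here → z≤n ; (there y∈S) → s≤s (≤w y∈S) }
greatest (s ∷ S) (zero , x∈S) | no empty = zero , x∈S , λ { here → z≤n ; (there y∈S) → ⊥-elim (empty (_ , y∈S)) }
greatest (s ∷ S) (suc x , there x∈S) | no empty = ⊥-elim (empty (x , x∈S))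

bounded-missing⇒∣p∣< : ∀ {n k} (S : Subset n) → (∀ {y} → y ∈ S → toℕ y < k)
  → ∀ {x} → toℕ x < k → x ∉ S → ∣ S ∣ < k
bounded-missing⇒∣p∣< {k = suc k} S bounded {x} x<k x∉S = s≤s (Finₚ.injective⇒≤ λ eq →
  elemAt-injective S (lower-injective (Finₚ.punchOut-injective (x≢ _) (x≢ _) eq)))
  where
  lower : Fin ∣ S ∣ → Fin (suc k)
  lower i = fromℕ< (bounded (elemAt-∈ S i))
  lower-injective : ∀ {i j} → lower i ≡ lower j → elemAt S i ≡ elemAt S j
  lower-injective eq = toℕ-injective (Finₚ.fromℕ<-injective _ _ _ _ eq)
  x≢ : ∀ i → fromℕ< x<k ≢ lower i
  x≢ i eq = x∉S (subst (_∈ S) (sym (toℕ-injective (Finₚ.fromℕ<-injective _ _ _ _ eq))) (elemAt-∈ S i))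

noIncreasingTriple⇒∣p∣≤2 : ∀ {n} (S : Subset n)
  → (∀ {x y z} → x ∈ S → y ∈ S → z ∈ S → x Fin.< y → y Fin.< z → ⊥) → ∣ S ∣ ≤ 2
noIncreasingTriple⇒∣p∣≤2 S noTriple with ∣ S ∣ ≤? 2
... | yes ≤2 = ≤2
... | no ≰2 = ⊥-elim (noTriple (elemAt-∈ S i₀) (elemAt-∈ S i₁) (elemAt-∈ S i₂)
                        (elemAt-strictMono S i₀<i₁) (elemAt-strictMono S i₁<i₂))
  where
  i₀ i₁ i₂ : Fin ∣ S ∣
  i₀ = fromℕ< (≤-trans (s≤s z≤n) (≰⇒> ≰2))
  i₁ = fromℕ< (≤-trans (s≤s (s≤s z≤n)) (≰⇒> ≰2))
  i₂ = fromℕ< (≰⇒> ≰2)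
  i₀<i₁ : i₀ Fin.< i₁
  i₀<i₁ = subst₂ _<_ (sym (toℕ-fromℕ< _)) (sym (toℕ-fromℕ< _)) (s≤s z≤n)
  i₁<i₂ : i₁ Fin.< i₂
  i₁<i₂ = subst₂ _<_ (sym (toℕ-fromℕ< _)) (sym (toℕ-fromℕ< _)) (s≤s (s≤s z≤n))

module Residues (p : ℕ) .{{_ : NonZero p}} where

  ⟦_⟧ : ℕ → Fin p
  ⟦ n ⟧ = n mod p

  toℕ-⟦⟧ : ∀ n → toℕ ⟦ n ⟧ ≡ n % p
  toℕ-⟦⟧ n = toℕ-fromℕ< (m%n<n n p)

  ⟦⟧≡⇒%≡ : ∀ {m n} → ⟦ m ⟧ ≡ ⟦ n ⟧ → m % p ≡ n % p
  ⟦⟧≡⇒%≡ {m} {n} eq = trans (sym (toℕ-⟦⟧ m)) (trans (cong toℕ eq) (toℕ-⟦⟧ n))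

  %≡⇒⟦⟧≡ : ∀ {m n} → m % p ≡ n % p → ⟦ m ⟧ ≡ ⟦ n ⟧
  %≡⇒⟦⟧≡ {m} {n} eq = toℕ-injective (trans (toℕ-⟦⟧ m) (trans eq (sym (toℕ-⟦⟧ n))))

  toℕ-⟦⟧-< : ∀ {n} → n < p → toℕ ⟦ n ⟧ ≡ n
  toℕ-⟦⟧-< {n} n<p = trans (toℕ-⟦⟧ n) (m<n⇒m%n≡m n<p)

  ⟦toℕ⟧ : ∀ x → ⟦ toℕ x ⟧ ≡ x
  ⟦toℕ⟧ x = toℕ-injective (toℕ-⟦⟧-< (toℕ<n x))

  ⟦⟧-+-cong : ∀ {m m′ n n′} → ⟦ m ⟧ ≡ ⟦ m′ ⟧ → ⟦ n ⟧ ≡ ⟦ n′ ⟧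
    → ⟦ m + n ⟧ ≡ ⟦ m′ + n′ ⟧
  ⟦⟧-+-cong {m} {m′} {n} {n′} m≡ n≡ = %≡⇒⟦⟧≡ (begin
    (m + n) % p             ≡⟨ %-distribˡ-+ m n p ⟩
    (m % p + n % p) % p     ≡⟨ cong₂ (λ a b → (a + b) % p) (⟦⟧≡⇒%≡ m≡) (⟦⟧≡⇒%≡ n≡) ⟩
    (m′ % p + n′ % p) % p   ≡⟨ %-distribˡ-+ m′ n′ p ⟨
    (m′ + n′) % p           ∎)
    where open ≡-Reasoning

  ⟦⟧-*-cong : ∀ {m m′ n n′} → ⟦ m ⟧ ≡ ⟦ m′ ⟧ → ⟦ n ⟧ ≡ ⟦ n′ ⟧
    → ⟦ m * n ⟧ ≡ ⟦ m′ * n′ ⟧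
  ⟦⟧-*-cong {m} {m′} {n} {n′} m≡ n≡ = %≡⇒⟦⟧≡ (begin
    (m * n) % p             ≡⟨ %-distribˡ-* m n p ⟩
    (m % p * (n % p)) % p   ≡⟨ cong₂ (λ a b → (a * b) % p) (⟦⟧≡⇒%≡ m≡) (⟦⟧≡⇒%≡ n≡) ⟩
    (m′ % p * (n′ % p)) % p ≡⟨ %-distribˡ-* m′ n′ p ⟨
    (m′ * n′) % p           ∎)
    where open ≡-Reasoning

  -- Adding p ∸ x % p undoes adding x, since (p ∸ x % p) + x is a multiple of p.
  ⟦⟧-+-cancelˡ : ∀ x {t t′} → ⟦ x + t ⟧ ≡ ⟦ x + t′ ⟧ → ⟦ t ⟧ ≡ ⟦ t′ ⟧
  ⟦⟧-+-cancelˡ x {t} {t′} eq = trans (sym (undo t)) (trans (⟦⟧-+-cong {x⁻} refl eq) (undo t′))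
    where
    x⁻ = p ∸ x % p
    undo : ∀ t → ⟦ x⁻ + (x + t) ⟧ ≡ ⟦ t ⟧
    undo t = %≡⇒⟦⟧≡ (begin
      (x⁻ + (x + t)) % p                         ≡⟨ cong (λ y → (x⁻ + (y + t)) % p) (m≡m%n+[m/n]*n x p) ⟩
      (x⁻ + ((x % p + x / p * p) + t)) % p       ≡⟨ cong (_% p) (rearrange x⁻ (x % p) (x / p * p) t) ⟩
      (t + ((x⁻ + x % p) + x / p * p)) % p       ≡⟨ cong (λ y → (t + (y + x / p * p)) % p) (m∸n+n≡m (m%n≤n x p)) ⟩
      (t + (1 + x / p) * p) % p                  ≡⟨ [m+kn]%n≡m%n t (1 + x / p) p ⟩
      t % p                                      ∎)
      where
      open ≡-Reasoning
      open +-*-Solver using (solve; _:+_; _:=_)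
      rearrange : ∀ a b c d → a + ((b + c) + d) ≡ d + ((a + b) + c)
      rearrange = solve 4 (λ a b c d → a :+ ((b :+ c) :+ d) := d :+ ((a :+ b) :+ c)) refl

  ⟦⟧-injective-< : ∀ {t t′} → ⟦ t ⟧ ≡ ⟦ t′ ⟧ → t < p → t′ < p → t ≡ t′
  ⟦⟧-injective-< {t} {t′} eq t<p t′<p = trans (sym (toℕ-⟦⟧-< t<p)) (trans (cong toℕ eq) (toℕ-⟦⟧-< t′<p))

  ⟦x+⟧-injective-< : ∀ x {t t′} → ⟦ x + t ⟧ ≡ ⟦ x + t′ ⟧ → t < p → t′ < p → t ≡ t′
  ⟦x+⟧-injective-< x eq = ⟦⟧-injective-< (⟦⟧-+-cancelˡ x eq)

  ⟦toℕ+p⟧ : ∀ x → ⟦ toℕ x + p ⟧ ≡ x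
  ⟦toℕ+p⟧ x = trans (%≡⇒⟦⟧≡ ([m+n]%n≡m%n (toℕ x) p)) (⟦toℕ⟧ x)

  ∣∧<⇒≡0 : ∀ {n} → p ∣ n → n < p → n ≡ 0
  ∣∧<⇒≡0 p∣n n<p = trans (sym (m<n⇒m%n≡m n<p)) (n∣m⇒m%n≡0 _ p p∣n)

  ⟦x+*d⟧-≡⇒≤ : Prime p → ∀ x {d j j′} → ¬ p ∣ d → ⟦ x + j * d ⟧ ≡ ⟦ x + j′ * d ⟧
    → j ≤ j′ → j′ < p → j′ ≤ j
  ⟦x+*d⟧-≡⇒≤ p-prime x {d} {j} {j′} p∤d eq j≤j′ j′<p with euclidsLemma (j′ ∸ j) d p-prime p∣[j′∸j]*d
    where
    j′*d≡ : x + j′ * d ≡ (x + j * d) + (j′ ∸ j) * d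
    j′*d≡ = trans (cong (λ i → x + i * d) (sym (m+[n∸m]≡n j≤j′)))
              (trans (cong (x +_) (*-distribʳ-+ d j (j′ ∸ j))) (sym (+-assoc x (j * d) _)))
    p∣[j′∸j]*d : p ∣ (j′ ∸ j) * d
    p∣[j′∸j]*d = m%n≡0⇒n∣m _ p (trans (sym (⟦⟧≡⇒%≡ (⟦⟧-+-cancelˡ (x + j * d)
      (trans (cong ⟦_⟧ (+-identityʳ _)) (trans eq (cong ⟦_⟧ j′*d≡)))))) (m<n⇒m%n≡m (>-nonZero⁻¹ p)))
  ... | inj₂ p∣d = ⊥-elim (p∤d p∣d)
  ... | inj₁ p∣j′∸j = m∸n≡0⇒m≤n (∣∧<⇒≡0 p∣j′∸j (≤-<-trans (m∸n≤m j′ j) j′<p))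

  ⟦x+*d⟧-injective-< : Prime p → ∀ x {d j j′} → ¬ p ∣ d → ⟦ x + j * d ⟧ ≡ ⟦ x + j′ * d ⟧
    → j < p → j′ < p → j ≡ j′
  ⟦x+*d⟧-injective-< p-prime x p∤d eq j<p j′<p with ≤-total _ _
  ... | inj₁ j≤j′ = ≤-antisym j≤j′ (⟦x+*d⟧-≡⇒≤ p-prime x p∤d eq j≤j′ j′<p)
  ... | inj₂ j′≤j = ≤-antisym (⟦x+*d⟧-≡⇒≤ p-prime x p∤d (sym eq) j′≤j j<p) j′≤j

module RestrictedSumWithInterval (p : ℕ) .{{_ : NonZero p}} (q : ℕ) (β : Subset p) where
  open Residues p

  k : ℕ
  k = suc (suc q)

  -- [0, k) +̂ β, with a < k compared to b as numbers: the restricted sum as long as k ≤ p.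
  InRestrictedSum : Fin p → Set
  InRestrictedSum c = ∃ λ (a : Fin k) → ∃ λ b → b ∈ β × toℕ a ≢ toℕ b × c ≡ ⟦ toℕ a + toℕ b ⟧

  InRestrictedSum? : ∀ c → Dec (InRestrictedSum c)
  InRestrictedSum? c = Finₚ.any? λ a → Finₚ.any? λ b →
    (b Subsetₚ.∈? β) ×-dec ¬? (toℕ a ≟ toℕ b) ×-dec (c Finₚ.≟ ⟦ toℕ a + toℕ b ⟧)

  R̂ : Subset p
  R̂ = ⟪ InRestrictedSum? ⟫

  ∈R̂ : ∀ {a b c} → a < k → b ∈ β → a ≢ toℕ b → c ≡ ⟦ a + toℕ b ⟧ → c ∈ R̂
  ∈R̂ {a} {b} a<k b∈β a≢b c≡ = from (∈⟪⟫⇔ InRestrictedSum?)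
    (fromℕ< a<k , b , b∈β , subst (_≢ toℕ b) (sym toℕ-a) a≢b ,
     trans c≡ (cong (λ x → ⟦ x + toℕ b ⟧) (sym toℕ-a)))
    where toℕ-a = toℕ-fromℕ< a<k

  -- How β ≢ [0, k) enters the argument: a subset of [0, k) other than [0, k) itself is smaller.
  DiffersFromInterval : Set
  DiffersFromInterval = (∀ {y} → y ∈ β → toℕ y < k) → ∣ β ∣ < k

  Covered : Fin p → Set
  Covered c = ∃ λ (a : Fin k) → ∃ λ b → b ∈ β × c ≡ ⟦ toℕ a + toℕ b ⟧

  Covered? : ∀ c → Dec (Covered c)
  Covered? c = Finₚ.any? λ a → Finₚ.any? λ b → (b Subsetₚ.∈? β) ×-dec (c Finₚ.≟ ⟦ toℕ a + toℕ b ⟧)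

  Lonely : Fin p → Set
  Lonely b = b ∈ β × toℕ b < k × ⟦ toℕ b + toℕ b ⟧ ∉ R̂

  Lonely? : ∀ b → Dec (Lonely b)
  Lonely? b = (b Subsetₚ.∈? β) ×-dec (toℕ b <? k) ×-dec ¬? (_ Subsetₚ.∈? R̂)

  lonely-onlySelfSum : ∀ {y} → Lonely y → ∀ {a b} → a < k → b ∈ β
    → a + toℕ b ≡ toℕ y + toℕ y → a ≡ toℕ b
  lonely-onlySelfSum (_ , _ , 2y∉R̂) {a} {b} a<k b∈β sum with a ≟ toℕ b
  ... | yes a≡b = a≡b
  ... | no a≢b = ⊥-elim (2y∉R̂ (∈R̂ a<k b∈β a≢b (cong ⟦_⟧ (sym sum))))

  private
    double-< : ∀ {m n} → m < n → m + m < n + n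
    double-< m<n = +-mono-< m<n m<n

  lonely-gap : ∀ {x y} → Lonely x → Lonely y → x Fin.< y → toℕ x + toℕ x < toℕ y
  lonely-gap {x} {y} lonely-x@(_ , x<k , _) (y∈β , _) x<y with toℕ y ≤? toℕ x + toℕ x
  ... | no y≰2x = ≰⇒> y≰2x
  ... | yes y≤2x = ⊥-elim (<-irrefl 2x≡2y (double-< x<y))
    where
    a = toℕ x + toℕ x ∸ toℕ y
    a+y≡2x : a + toℕ y ≡ toℕ x + toℕ x
    a+y≡2x = m∸n+n≡m y≤2x
    a≤x : a ≤ toℕ x
    a≤x = ≤-trans (∸-monoʳ-≤ (toℕ x + toℕ x) (<⇒≤ x<y)) (≤-reflexive (m+n∸m≡n (toℕ x) (toℕ x)))
    2x≡2y : toℕ x + toℕ x ≡ toℕ y + toℕ y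
    2x≡2y = trans (sym a+y≡2x) (cong (_+ toℕ y) (lonely-onlySelfSum lonely-x (≤-<-trans a≤x x<k) y∈β a+y≡2x))

  lonely-spread : ∀ {x y} → Lonely x → Lonely y → x Fin.< y → toℕ x + k ≤ toℕ y + toℕ y
  lonely-spread {x} {y} (x∈β , _) lonely-y x<y with toℕ x + k ≤? toℕ y + toℕ y
  ... | yes x+k≤2y = x+k≤2y
  ... | no x+k≰2y = ⊥-elim (<-irrefl (sym 2y≡2x) (double-< x<y))
    where
    x≤2y : toℕ x ≤ toℕ y + toℕ y
    x≤2y = ≤-trans (<⇒≤ x<y) (m≤m+n (toℕ y) (toℕ y))
    a = toℕ y + toℕ y ∸ toℕ x
    a+x≡2y : a + toℕ x ≡ toℕ y + toℕ y
    a+x≡2y = m∸n+n≡m x≤2y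
    a<k : a < k
    a<k = +-cancelʳ-< (toℕ x) a k
      (subst₂ _<_ (sym a+x≡2y) (+-comm (toℕ x) k) (≰⇒> x+k≰2y))
    2y≡2x : toℕ y + toℕ y ≡ toℕ x + toℕ x
    2y≡2x = trans (sym a+x≡2y) (cong (_+ toℕ x) (lonely-onlySelfSum lonely-y a<k x∈β a+x≡2y))

  ∣lonely∣≤2 : ∣ ⟪ Lonely? ⟫ ∣ ≤ 2
  ∣lonely∣≤2 = noIncreasingTriple⇒∣p∣≤2 ⟪ Lonely? ⟫ λ x∈ y∈ z∈ x<y y<z →
    <-irrefl refl (≤-<-trans (m≤n+m k (toℕ _)) (≤-<-trans (lonely-spread (lonely x∈) (lonely y∈) x<y)
      (<-trans (lonely-gap (lonely y∈) (lonely z∈) y<z) (proj₁ (proj₂ (lonely z∈))))))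
    where
    lonely : ∀ {b} → b ∈ ⟪ Lonely? ⟫ → Lonely b
    lonely = to (∈⟪⟫⇔ Lonely?)

  covered∉R̂⇒lonely : ∀ {c} → c ∉ R̂ → ((a , b , _) : Covered c) → Lonely b × c ≡ ⟦ toℕ b + toℕ b ⟧
  covered∉R̂⇒lonely {c} c∉R̂ (a , b , b∈β , c≡) with toℕ a ≟ toℕ b
  ... | no a≢b = ⊥-elim (c∉R̂ (∈R̂ (toℕ<n a) b∈β a≢b c≡))
  ... | yes a≡b = (b∈β , subst (_< k) a≡b (toℕ<n a) , subst (_∉ R̂) c≡2b c∉R̂) , c≡2b
    where c≡2b = trans c≡ (cong (λ x → ⟦ x + toℕ b ⟧) a≡b)

  allCovered⇒p≤2+∣R̂∣ : (∀ c → Covered c) → p ≤ 2 + ∣ R̂ ∣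
  allCovered⇒p≤2+∣R̂∣ covered = begin
    p                         ≤⟨ m≤n+m∸n p ∣ R̂ ∣ ⟩
    ∣ R̂ ∣ + (p ∸ ∣ R̂ ∣)       ≡⟨ cong (∣ R̂ ∣ +_) (Subsetₚ.∣∁p∣≡n∸∣p∣ R̂) ⟨
    ∣ R̂ ∣ + ∣ ∁ R̂ ∣            ≤⟨ +-monoʳ-≤ ∣ R̂ ∣ (≤-trans ∣∁R̂∣≤∣lonely∣ ∣lonely∣≤2) ⟩
    ∣ R̂ ∣ + 2                 ≡⟨ +-comm ∣ R̂ ∣ 2 ⟩
    2 + ∣ R̂ ∣                 ∎
    where
    open ≤-Reasoning
    root : Fin p → Fin p
    root c = proj₁ (proj₂ (covered c))
    lonelyRoot : ∀ {c} → c ∈ ∁ R̂ → Lonely (root c) × c ≡ ⟦ toℕ (root c) + toℕ (root c) ⟧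
    lonelyRoot {c} c∈∁R̂ = covered∉R̂⇒lonely (Subsetₚ.x∈∁p⇒x∉p c∈∁R̂) (covered c)
    ∣∁R̂∣≤∣lonely∣ : ∣ ∁ R̂ ∣ ≤ ∣ ⟪ Lonely? ⟫ ∣
    ∣∁R̂∣≤∣lonely∣ = injectsInto⇒∣p∣≤∣q∣ (∁ R̂) ⟪ Lonely? ⟫ root
      (λ c∈ c′∈ same-root → trans (proj₂ (lonelyRoot c∈))
        (trans (cong (λ b → ⟦ toℕ b + toℕ b ⟧) same-root) (sym (proj₂ (lonelyRoot c′∈)))))
      (λ c∈ → from (∈⟪⟫⇔ Lonely?) (proj₁ (lonelyRoot c∈)))

  endpoints⇒2q+1≤∣R̂∣ : ∀ {b₀ b₁} → b₀ ∈ β → toℕ b₀ ≡ 0 → b₁ ∈ β → toℕ b₁ ≡ suc q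
    → suc q + q < p → suc q + q ≤ ∣ R̂ ∣
  endpoints⇒2q+1≤∣R̂∣ {b₀} {b₁} b₀∈β b₀≡0 b₁∈β b₁≡1+q 2q+1<p = injective⇒≤∣p∣ R̂ f-injective f∈R̂
    where
    f : Fin (suc q + q) → Fin p
    f i = ⟦ suc (toℕ i) ⟧
    toℕ-f : ∀ i → toℕ (f i) ≡ suc (toℕ i)
    toℕ-f i = toℕ-⟦⟧-< (≤-<-trans (toℕ<n i) 2q+1<p)
    f-injective : Injective _≡_ _≡_ f
    f-injective {i} {j} eq = toℕ-injective (suc-injective (trans (sym (toℕ-f i)) (trans (cong toℕ eq) (toℕ-f j))))
    f∈R̂ : ∀ i → f i ∈ R̂
    f∈R̂ i with suc (toℕ i) ≤? suc q
    ... | yes 1+i≤1+q = ∈R̂ (s≤s 1+i≤1+q) b₀∈β (λ eq → 1+n≢0 (trans eq b₀≡0))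
                          (cong ⟦_⟧ (sym (trans (cong (suc (toℕ i) +_) b₀≡0) (+-identityʳ _))))
    ... | no 1+i≰1+q =
      ∈R̂ (s≤s (m≤n⇒m≤1+n a≤q)) b₁∈β (λ eq → 1+n≰n (≤-trans (≤-reflexive (sym (trans eq b₁≡1+q))) a≤q))
                          (cong ⟦_⟧ (sym (trans (cong (a +_) b₁≡1+q) (m∸n+n≡m (<⇒≤ (≰⇒> 1+i≰1+q))))))
      where
      a = suc (toℕ i) ∸ suc q
      a≤q : a ≤ q
      a≤q = ≤-trans (∸-monoˡ-≤ (suc q) (toℕ<n i)) (≤-reflexive (m+n∸m≡n (suc q) q))

  module Uncovered (c₀ : Fin p) (c₀-uncovered : ¬ Covered c₀) where

    shift : ℕ → Fin p
    shift t = ⟦ suc (toℕ c₀) + t ⟧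

    shift-injective-< : ∀ {t t′} → shift t ≡ shift t′ → t < p → t′ < p → t ≡ t′
    shift-injective-< = ⟦x+⟧-injective-< (suc (toℕ c₀))

    shift-+ : ∀ t a → shift (t + a) ≡ ⟦ a + toℕ (shift t) ⟧
    shift-+ t a = trans (cong ⟦_⟧ (trans (sym (+-assoc s t a)) (+-comm (s + t) a)))
                        (⟦⟧-+-cong {a} refl (sym (⟦toℕ⟧ (shift t))))
      where s = suc (toℕ c₀)

    T : Subset p
    T = ⟪ (λ t → shift (toℕ t) Subsetₚ.∈? β) ⟫

    T⇔ : ∀ {t} → t ∈ T ⇔ shift (toℕ t) ∈ β
    T⇔ = ∈⟪⟫⇔ _

    -- If p ≤ t + k then a = p ∸ (t + 1) < k and a + shift t ≡ c₀, so c₀ would be covered.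
    T-noWrap : ∀ {t} → t ∈ T → toℕ t + k < p
    T-noWrap {t} t∈T with p ≤? toℕ t + k
    ... | no p≰t+k = ≰⇒> p≰t+k
    ... | yes p≤t+k = ⊥-elim (c₀-uncovered (fromℕ< a<k , shift (toℕ t) , to T⇔ t∈T , c₀≡))
      where
      a = p ∸ suc (toℕ t)
      a<k : a < k
      a<k = s≤s (≤-trans (∸-monoˡ-≤ (suc (toℕ t)) p≤t+k)
                (≤-reflexive (trans (cong (_∸ suc (toℕ t)) (+-suc (toℕ t) (suc q))) (m+n∸m≡n (toℕ t) (suc q)))))
      wraps : suc (toℕ c₀) + (toℕ t + a) ≡ toℕ c₀ + p
      wraps = trans (sym (+-suc (toℕ c₀) _)) (cong (toℕ c₀ +_)
        (trans (cong suc (+-comm (toℕ t) a)) (trans (sym (+-suc a (toℕ t))) (m∸n+n≡m (toℕ<n t)))))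
      c₀≡ : c₀ ≡ ⟦ toℕ (fromℕ< a<k) + toℕ (shift (toℕ t)) ⟧
      c₀≡ = begin
        c₀                                     ≡⟨ ⟦toℕ+p⟧ c₀ ⟨
        ⟦ toℕ c₀ + p ⟧                         ≡⟨ cong ⟦_⟧ wraps ⟨
        shift (toℕ t + a)                      ≡⟨ shift-+ (toℕ t) a ⟩
        ⟦ a + toℕ (shift (toℕ t)) ⟧            ≡⟨ cong (λ x → ⟦ x + toℕ (shift (toℕ t)) ⟧) (toℕ-fromℕ< a<k) ⟨
        ⟦ toℕ (fromℕ< a<k) + toℕ (shift (toℕ t)) ⟧ ∎
        where open ≡-Reasoning

    T+e<p : ∀ {t e} → t ∈ T → e < k → toℕ t + e < p
    T+e<p {t} t∈T e<k = <-trans (+-monoʳ-< (toℕ t) e<k) (T-noWrap t∈T)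

    unshift : Fin p → Fin p
    unshift x = ⟦ toℕ x + (p ∸ suc (toℕ c₀)) ⟧

    shift-unshift : ∀ x → shift (toℕ (unshift x)) ≡ x
    shift-unshift x = begin
      ⟦ s + toℕ ⟦ toℕ x + (p ∸ s) ⟧ ⟧   ≡⟨ ⟦⟧-+-cong {s} refl (⟦toℕ⟧ _) ⟩
      ⟦ s + (toℕ x + (p ∸ s)) ⟧          ≡⟨ cong ⟦_⟧ (x∙yz≈y∙xz s (toℕ x) (p ∸ s)) ⟩
      ⟦ toℕ x + (s + (p ∸ s)) ⟧          ≡⟨ cong (λ y → ⟦ toℕ x + y ⟧) (m+[n∸m]≡n (toℕ<n c₀)) ⟩
      ⟦ toℕ x + p ⟧                      ≡⟨ ⟦toℕ+p⟧ x ⟩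
      x                                  ∎
      where
      open ≡-Reasoning
      s = suc (toℕ c₀)

    unshift-∈T : ∀ {x} → x ∈ β → unshift x ∈ T
    unshift-∈T {x} x∈β = from T⇔ (subst (_∈ β) (sym (shift-unshift x)) x∈β)

    ∣β∣≤∣T∣ : ∣ β ∣ ≤ ∣ T ∣
    ∣β∣≤∣T∣ = injectsInto⇒∣p∣≤∣q∣ β T unshift
      (λ {x} {y} _ _ eq → trans (sym (shift-unshift x)) (trans (cong (shift ∘ toℕ) eq) (shift-unshift y)))
      unshift-∈T

    BlockedInBothParts : Fin p → (Fin (suc q) → ℕ) → ℕ → Set
    BlockedInBothParts base offset a₀ =
      (∃ λ j → offset j ≡ toℕ (shift (toℕ base))) × (∃ λ t → t ∈ T × a₀ ≡ toℕ (shift (toℕ t)))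

    BlockedInBothParts? : ∀ base offset a₀ → Dec (BlockedInBothParts base offset a₀)
    BlockedInBothParts? base offset a₀ = Finₚ.any? (λ j → offset j ≟ _)
      ×-dec Finₚ.any? (λ t → (t Subsetₚ.∈? T) ×-dec (a₀ ≟ _))

    -- The integers base + offset j and t + a₀ (t ∈ T) are distinct and below p. Through shift each
    -- is a sum in [0, k) + β, which is restricted unless its two summands agree; that happens at most
    -- once in each part of the chain.
    chain-bound : ∀ {base} → base ∈ T → (offset : Fin (suc q) → ℕ) → Injective _≡_ _≡_ offset
      → (∀ j → offset j < k) → ∀ {a₀} → a₀ < k → (∀ j {t} → t ∈ T → toℕ base + offset j ≢ toℕ t + a₀)
      → ¬ BlockedInBothParts base offset a₀ → q + ∣ T ∣ ≤ ∣ R̂ ∣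
    chain-bound {base} base∈T offset offset-injective offset<k {a₀} a₀<k disjoint notBlocked =
      injective⊎-allButOne⇒∸1≤∣p∣ R̂ {f = chain} chain-injective atMostOneMiss
      where
      tᵢ : Fin ∣ T ∣ → Fin p
      tᵢ = elemAt T

      chain : Fin (suc q) ⊎ Fin ∣ T ∣ → Fin p
      chain (inj₁ j) = shift (toℕ base + offset j)
      chain (inj₂ i) = shift (toℕ (tᵢ i) + a₀)

      left<p : ∀ j → toℕ base + offset j < p
      left<p j = T+e<p base∈T (offset<k j)
      right<p : ∀ i → toℕ (tᵢ i) + a₀ < p
      right<p i = T+e<p (elemAt-∈ T i) a₀<k

      chain-injective : Injective _≡_ _≡_ chain
      chain-injective {inj₁ j} {inj₁ j′} eq =
        cong inj₁ (offset-injective (+-cancelˡ-≡ (toℕ base) _ _ (shift-injective-< eq (left<p j) (left<p j′))))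
      chain-injective {inj₂ i} {inj₂ i′} eq = cong inj₂ (elemAt-injective T (toℕ-injective
        (+-cancelʳ-≡ _ _ _ (shift-injective-< eq (right<p i) (right<p i′)))))
      chain-injective {inj₁ j} {inj₂ i} eq =
        ⊥-elim (disjoint j (elemAt-∈ T i) (shift-injective-< eq (left<p j) (right<p i)))
      chain-injective {inj₂ i} {inj₁ j} eq =
        ⊥-elim (disjoint j (elemAt-∈ T i) (shift-injective-< (sym eq) (left<p j) (right<p i)))

      Miss : Fin (suc q) ⊎ Fin ∣ T ∣ → Set
      Miss (inj₁ j) = offset j ≡ toℕ (shift (toℕ base))
      Miss (inj₂ i) = a₀ ≡ toℕ (shift (toℕ (tᵢ i)))

      ∉R̂⇒Miss : ∀ x → chain x ∉ R̂ → Miss x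
      ∉R̂⇒Miss (inj₁ j) ∉R̂ = decidable-stable (_ ≟ _) λ ¬miss →
        ∉R̂ (∈R̂ (offset<k j) (to T⇔ base∈T) ¬miss (shift-+ (toℕ base) (offset j)))
      ∉R̂⇒Miss (inj₂ i) ∉R̂ = decidable-stable (_ ≟ _) λ ¬miss →
        ∉R̂ (∈R̂ a₀<k (to T⇔ (elemAt-∈ T i)) ¬miss (shift-+ (toℕ (tᵢ i)) a₀))

      missesUnique : ∀ x y → Miss x → Miss y → x ≡ y
      missesUnique (inj₁ j) (inj₁ j′) mj mj′ = cong inj₁ (offset-injective (trans mj (sym mj′)))
      missesUnique (inj₂ i) (inj₂ i′) mi mi′ = cong inj₂ (elemAt-injective T (toℕ-injective
        (shift-injective-< (toℕ-injective (trans (sym mi) mi′)) (toℕ<n (tᵢ i)) (toℕ<n (tᵢ i′)))))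
      missesUnique (inj₁ j) (inj₂ i) mj mi = ⊥-elim (notBlocked ((j , mj) , tᵢ i , elemAt-∈ T i , mi))
      missesUnique (inj₂ i) (inj₁ j) mi mj = ⊥-elim (notBlocked ((j , mj) , tᵢ i , elemAt-∈ T i , mi))

      atMostOneMiss : ∀ x y → chain x ∉ R̂ → chain y ∉ R̂ → x ≡ y
      atMostOneMiss x y x∉ y∉ = missesUnique x y (∉R̂⇒Miss x x∉) (∉R̂⇒Miss y y∉)

    chainFromLeast-bound : ∀ {u} → u ∈ T → (∀ {y} → y ∈ T → u Fin.≤ y)
      → ¬ BlockedInBothParts u toℕ (suc q) → q + ∣ T ∣ ≤ ∣ R̂ ∣
    chainFromLeast-bound {u} u∈T u-least = chain-bound u∈T toℕ toℕ-injective
      (λ j → <-trans (toℕ<n j) (n<1+n (suc q))) (n<1+n (suc q))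
      λ j t∈T eq → <-irrefl eq (<-≤-trans (+-monoʳ-< (toℕ u) (toℕ<n j)) (+-monoˡ-≤ (suc q) (u-least t∈T)))

    chainToGreatest-bound : ∀ {w} → w ∈ T → (∀ {y} → y ∈ T → y Fin.≤ w)
      → ¬ BlockedInBothParts w (suc ∘ toℕ) 0 → q + ∣ T ∣ ≤ ∣ R̂ ∣
    chainToGreatest-bound {w} w∈T w-greatest = chain-bound w∈T (suc ∘ toℕ) (toℕ-injective ∘ suc-injective)
      (λ j → s≤s (toℕ<n j)) (s≤s z≤n)
      λ j t∈T eq → <-irrefl (sym eq)
        (≤-<-trans (≤-trans (≤-reflexive (+-identityʳ _)) (w-greatest t∈T)) (m<m+n (toℕ w) (s≤s z≤n)))

    module AnchoredAt {t₀} (t₀∈T : t₀ ∈ T) (shift-t₀≡0 : 0 ≡ toℕ (shift (toℕ t₀))) where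

      toℕ-shift-t₀+ : ∀ {e} → e < p → toℕ (shift (toℕ t₀ + e)) ≡ e
      toℕ-shift-t₀+ {e} e<p = begin
        toℕ (shift (toℕ t₀ + e))           ≡⟨ cong toℕ (shift-+ (toℕ t₀) e) ⟩
        toℕ ⟦ e + toℕ (shift (toℕ t₀)) ⟧    ≡⟨ cong (λ z → toℕ ⟦ e + z ⟧) shift-t₀≡0 ⟨
        toℕ ⟦ e + 0 ⟧                      ≡⟨ cong (toℕ ∘ ⟦_⟧) (+-identityʳ e) ⟩
        toℕ ⟦ e ⟧                          ≡⟨ toℕ-⟦⟧-< e<p ⟩
        e                                  ∎
        where open ≡-Reasoning

      locate : ∀ {t e} → t < p → e < k → toℕ (shift t) ≡ e → t ≡ toℕ t₀ + e
      locate t<p e<k shift-t≡e =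
        shift-injective-< (toℕ-injective (trans shift-t≡e (sym (toℕ-shift-t₀+ (<-trans e<k k<p)))))
          t<p (T+e<p t₀∈T e<k)
        where
        k<p : k < p
        k<p = ≤-<-trans (m≤n+m k (toℕ t₀)) (T-noWrap t₀∈T)

    -- Here T ⊆ [t₀, t₀ + k) with shift t₀ = 0, so β ⊆ [0, k) contains both 0 and k ∸ 1.
    bothChainsBlocked⇒∣R̂∣ : ∀ {u w} → (∀ {y} → y ∈ T → u Fin.≤ y) → (∀ {y} → y ∈ T → y Fin.≤ w)
      → BlockedInBothParts u toℕ (suc q) → BlockedInBothParts w (suc ∘ toℕ) 0
      → DiffersFromInterval → q + ∣ β ∣ ≤ ∣ R̂ ∣
    bothChainsBlocked⇒∣R̂∣ {u} {w} u-least w-greatest ((j₁ , shift-u≡j₁) , t₁ , t₁∈T , shift-t₁≡1+q)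
                                                     ((j₂ , shift-w≡1+j₂) , t₀ , t₀∈T , shift-t₀≡0) ∣β∣<k =
      begin
        q + ∣ β ∣     ≤⟨ +-monoʳ-≤ q (≤-pred (∣β∣<k β-below-k)) ⟩
        q + suc q     ≡⟨ +-comm q (suc q) ⟩
        suc q + q     ≤⟨ endpoints⇒2q+1≤∣R̂∣ (to T⇔ t₀∈T) (sym shift-t₀≡0)
                                             (to T⇔ t₁∈T) (sym shift-t₁≡1+q) 2q+1<p ⟩
        ∣ R̂ ∣         ∎
      where
      open ≤-Reasoning
      open AnchoredAt t₀∈T shift-t₀≡0
      t₀≤T : ∀ {t} → t ∈ T → toℕ t₀ ≤ toℕ t
      t₀≤T t∈T = ≤-trans (m≤m+n _ _) (≤-trans (≤-reflexive (sym u≡)) (u-least t∈T))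
        where u≡ = locate (toℕ<n u) (subst (_< k) shift-u≡j₁ (<-trans (toℕ<n j₁) ≤-refl)) refl
      T≤t₀+1+q : ∀ {t} → t ∈ T → toℕ t ≤ toℕ t₀ + suc q
      T≤t₀+1+q t∈T = ≤-trans (w-greatest t∈T)
        (≤-trans (≤-reflexive w≡) (+-monoʳ-≤ (toℕ t₀) (subst (_≤ suc q) shift-w≡1+j₂ (toℕ<n j₂))))
        where w≡ = locate (toℕ<n w) (subst (_< k) shift-w≡1+j₂ (s≤s (toℕ<n j₂))) refl
      β-below-k : ∀ {y} → y ∈ β → toℕ y < k
      β-below-k {y} y∈β = s≤s (subst (_≤ suc q) (sym toℕ-y≡e) e≤1+q)
        where
        t = toℕ (unshift y)
        e = t ∸ toℕ t₀
        toℕ-y≡e : toℕ y ≡ e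
        toℕ-y≡e = begin-equality
          toℕ y                        ≡⟨ cong toℕ (shift-unshift y) ⟨
          toℕ (shift t)                ≡⟨ cong (toℕ ∘ shift) (m+[n∸m]≡n (t₀≤T (unshift-∈T y∈β))) ⟨
          toℕ (shift (toℕ t₀ + e))     ≡⟨ toℕ-shift-t₀+ (≤-<-trans (m∸n≤m t (toℕ t₀)) (toℕ<n (unshift y))) ⟩
          e                            ∎
        e≤1+q : e ≤ suc q
        e≤1+q = ≤-trans (∸-monoˡ-≤ (toℕ t₀) (T≤t₀+1+q (unshift-∈T y∈β))) (≤-reflexive (m+n∸m≡n (toℕ t₀) (suc q)))
      2q+1<p : suc q + q < p
      2q+1<p = ≤-<-trans (≤-trans (+-monoʳ-≤ (suc q) (≤-trans (n≤1+n q) (n≤1+n (suc q))))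
                             (≤-trans (m≤n+m (suc q + k) (toℕ t₀)) (≤-reflexive (sym (+-assoc (toℕ t₀) (suc q) k)))))
        (subst (λ t → t + k < p) (locate (toℕ<n t₁) ≤-refl (sym shift-t₁≡1+q)) (T-noWrap t₁∈T))

    uncovered⇒∣R̂∣ : Nonempty β → DiffersFromInterval → q + ∣ β ∣ ≤ ∣ R̂ ∣
    uncovered⇒∣R̂∣ (x₀ , x₀∈β) ∣β∣<k
      with least T (_ , unshift-∈T x₀∈β) | greatest T (_ , unshift-∈T x₀∈β)
    ... | u , u∈T , u-least | w , w∈T , w-greatest
      with BlockedInBothParts? u toℕ (suc q) | BlockedInBothParts? w (suc ∘ toℕ) 0
    ... | no lowOpen | _ = ≤-trans (+-monoʳ-≤ q ∣β∣≤∣T∣) (chainFromLeast-bound u∈T u-least lowOpen)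
    ... | yes _ | no highOpen = ≤-trans (+-monoʳ-≤ q ∣β∣≤∣T∣) (chainToGreatest-bound w∈T w-greatest highOpen)
    ... | yes lowBlocked | yes highBlocked = bothChainsBlocked⇒∣R̂∣ u-least w-greatest lowBlocked highBlocked ∣β∣<k

  ∣R̂∣-lowerBound : k + ∣ β ∣ ≤ p → Nonempty β → DiffersFromInterval → q + ∣ β ∣ ≤ ∣ R̂ ∣
  ∣R̂∣-lowerBound k+∣β∣≤p nonempty ∣β∣<k with Finₚ.all? Covered?
  ... | yes covered = ≤-pred (≤-pred (≤-trans k+∣β∣≤p (allCovered⇒p≤2+∣R̂∣ covered)))
  ... | no ¬covered with Finₚ.¬∀⟶∃¬ p Covered Covered? ¬covered
  ...   | c₀ , c₀-uncovered = Uncovered.uncovered⇒∣R̂∣ c₀ c₀-uncovered nonempty ∣β∣<k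

module AffineProgression (p : ℕ) .{{_ : NonZero p}} (p-prime : Prime p) (A B : Subset p) (q : ℕ)
                         (τ d : Fin p) (d≢0 : toℕ d ≢ 0) (A-progression : IsAP A τ d (suc (suc q)))
                         (2+q+∣B∣≤p : suc (suc q) + ∣ B ∣ ≤ p) where
  open Residues p

  p∤d : ¬ p ∣ toℕ d
  p∤d p∣d = d≢0 (∣∧<⇒≡0 p∣d (toℕ<n d))

  ι : ℕ → Fin p
  ι j = ⟦ toℕ τ + j * toℕ d ⟧

  ι-injective-< : ∀ {j j′} → ι j ≡ ι j′ → j < p → j′ < p → j ≡ j′
  ι-injective-< = ⟦x+*d⟧-injective-< p-prime (toℕ τ) p∤d

  ι-injective : Injective _≡_ _≡_ (ι ∘ toℕ)
  ι-injective {i} {j} eq = toℕ-injective (ι-injective-< eq (toℕ<n i) (toℕ<n j))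

  ι⁻¹ : Fin p → Fin p
  ι⁻¹ x = proj₁ (injective⇒surjective ι-injective x)

  ι-ι⁻¹ : ∀ x → ι (toℕ (ι⁻¹ x)) ≡ x
  ι-ι⁻¹ x = proj₂ (injective⇒surjective ι-injective x)

  β : Subset p
  β = ⟪ (λ j → ι (toℕ j) Subsetₚ.∈? B) ⟫

  β⇔ : ∀ {j} → j ∈ β ⇔ ι (toℕ j) ∈ B
  β⇔ = ∈⟪⟫⇔ _

  ι⁻¹-∈β : ∀ {x} → x ∈ B → ι⁻¹ x ∈ β
  ι⁻¹-∈β {x} x∈B = from β⇔ (subst (_∈ B) (sym (ι-ι⁻¹ x)) x∈B)

  ∣β∣≡∣B∣ : ∣ β ∣ ≡ ∣ B ∣
  ∣β∣≡∣B∣ = ≤-antisym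
    (injectsInto⇒∣p∣≤∣q∣ β B (ι ∘ toℕ) (λ _ _ → ι-injective) (to β⇔))
    (injectsInto⇒∣p∣≤∣q∣ B β ι⁻¹ (λ {x} {y} _ _ eq → trans (sym (ι-ι⁻¹ x))
      (trans (cong (ι ∘ toℕ) eq) (ι-ι⁻¹ y))) ι⁻¹-∈β)

  open RestrictedSumWithInterval p q β using (k; R̂; InRestrictedSum?; DiffersFromInterval; ∣R̂∣-lowerBound)

  k≤p : k ≤ p
  k≤p = ≤-trans (m≤m+n k _) 2+q+∣B∣≤p

  Discrepancy : Fin p → Set
  Discrepancy x = (x ∈ β × k ≤ toℕ x) ⊎ (x ∉ β × toℕ x < k)

  Discrepancy? : ∀ x → Dec (Discrepancy x)
  Discrepancy? x = ((x Subsetₚ.∈? β) ×-dec (k ≤? toℕ x)) ⊎-dec (¬? (x Subsetₚ.∈? β) ×-dec (toℕ x <? k))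

  noDiscrepancy⇒A≡B : (∀ x → ¬ Discrepancy x) → A ≡ B
  noDiscrepancy⇒A≡B consistent = Subsetₚ.⊆-antisym A⊆B B⊆A
    where
    A⊆B : ∀ {x} → x ∈ A → x ∈ B
    A⊆B {x} x∈A with proj₁ (A-progression x) x∈A
    ... | i , i<k , x≡ with fromℕ< (<-≤-trans i<k k≤p) Subsetₚ.∈? β
    ...   | yes i∈β = subst (_∈ B) (trans (cong ι (toℕ-fromℕ< (<-≤-trans i<k k≤p))) (sym x≡)) (to β⇔ i∈β)
    ...   | no i∉β =
      ⊥-elim (consistent _ (inj₂ (i∉β , subst (_< k) (sym (toℕ-fromℕ< (<-≤-trans i<k k≤p))) i<k)))
    B⊆A : ∀ {x} → x ∈ B → x ∈ A
    B⊆A {x} x∈B with k ≤? toℕ (ι⁻¹ x)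
    ... | yes k≤ = ⊥-elim (consistent _ (inj₁ (ι⁻¹-∈β x∈B , k≤)))
    ... | no k≰ = proj₂ (A-progression x) (toℕ (ι⁻¹ x) , ≰⇒> k≰ , sym (ι-ι⁻¹ x))

  discrepancy⇒differs : ∀ {x} → Discrepancy x → DiffersFromInterval
  discrepancy⇒differs (inj₁ (x∈β , k≤x)) β<k = ⊥-elim (<⇒≱ (β<k x∈β) k≤x)
  discrepancy⇒differs (inj₂ (x∉β , x<k)) β<k = bounded-missing⇒∣p∣< β β<k x<k x∉β

  σ : Fin p → Fin p
  σ c = ⟦ (toℕ τ + toℕ τ) + toℕ c * toℕ d ⟧

  σ-injective : Injective _≡_ _≡_ σ
  σ-injective {c} {c′} eq = toℕ-injective (⟦x+*d⟧-injective-< p-prime _ p∤d eq (toℕ<n c) (toℕ<n c′))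

  σ-sum : ∀ a b → σ ⟦ a + b ⟧ ≡ ι a +ₚ ι b
  σ-sum a b = begin
    ⟦ (t + t) + toℕ ⟦ a + b ⟧ * δ ⟧    ≡⟨ ⟦⟧-+-cong {t + t} refl (⟦⟧-*-cong (⟦toℕ⟧ _) refl) ⟩
    ⟦ (t + t) + (a + b) * δ ⟧          ≡⟨ cong ⟦_⟧ (distribute t a b δ) ⟩
    ⟦ (t + a * δ) + (t + b * δ) ⟧      ≡⟨ ⟦⟧-+-cong (sym (⟦toℕ⟧ (ι a))) (sym (⟦toℕ⟧ (ι b))) ⟩
    ⟦ toℕ (ι a) + toℕ (ι b) ⟧          ∎
    where
    open ≡-Reasoning
    open +-*-Solver using (solve; _:+_; _:*_; _:=_)
    t = toℕ τ
    δ = toℕ d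
    distribute : ∀ t a b δ → (t + t) + (a + b) * δ ≡ (t + a * δ) + (t + b * δ)
    distribute = solve 4 (λ t a b δ → (t :+ t) :+ (a :+ b) :* δ := (t :+ a :* δ) :+ (t :+ b :* δ)) refl

  σ-R̂⊆A+̂B : ∀ {c} → c ∈ R̂ → σ c ∈ A +̂ B
  σ-R̂⊆A+̂B c∈R̂ with to (∈⟪⟫⇔ InRestrictedSum?) c∈R̂
  ... | a , b , b∈β , a≢b , refl = from (∈⟪⟫⇔ (InRestrSum? A B))
    (ι (toℕ a) , ι (toℕ b) , ι-a∈A , to β⇔ b∈β , ι-a≢ι-b , σ-sum (toℕ a) (toℕ b))
    where
    ι-a∈A = proj₂ (A-progression _) (toℕ a , toℕ<n a , refl)
    ι-a≢ι-b = λ eq → a≢b (ι-injective-< eq (<-≤-trans (toℕ<n a) k≤p) (toℕ<n b))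

  A≡B⊎∣A+̂B∣≥ : Nonempty B → A ≡ B ⊎ q + ∣ B ∣ ≤ ∣ A +̂ B ∣
  A≡B⊎∣A+̂B∣≥ (b , b∈B) with Finₚ.any? Discrepancy?
  ... | no ¬discrepancy = inj₁ (noDiscrepancy⇒A≡B λ x disc → ¬discrepancy (x , disc))
  ... | yes (_ , disc) = inj₂ (begin
    q + ∣ B ∣     ≡⟨ cong (q +_) ∣β∣≡∣B∣ ⟨
    q + ∣ β ∣     ≤⟨ ∣R̂∣-lowerBound k+∣β∣≤p (_ , ι⁻¹-∈β b∈B) (discrepancy⇒differs disc) ⟩
    ∣ R̂ ∣         ≤⟨ injectsInto⇒∣p∣≤∣q∣ R̂ (A +̂ B) σ (λ _ _ → σ-injective) σ-R̂⊆A+̂B ⟩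
    ∣ A +̂ B ∣     ∎)
    where
    open ≤-Reasoning
    k+∣β∣≤p = subst (λ n → k + n ≤ p) (sym ∣β∣≡∣B∣) 2+q+∣B∣≤p

theorem7 : (p : ℕ) .{{_ : NonZero p}} → Prime p → (A B : Subset p)
    → ∣ A ∣ ≥ 5 → ∣ B ∣ ≥ 2 → p ≥ ∣ A ∣ + ∣ B ∣
    → ∣ A +̂ B ∣ ≡ ∣ A ∣ + ∣ B ∣ ∸ 3
    → (∃ λ τ → ∃ λ d → ¬ (toℕ d ≡ 0) × IsAP A τ d ∣ A ∣)
    → A ≡ B
theorem7 p p-prime A B ∣A∣≥5 ∣B∣≥2 ∣A∣+∣B∣≤p ∣A+̂B∣≡ (τ , d , d≢0 , A-progression) =
  fromInj₁ (⊥-elim ∘ ∣A+̂B∣-tooSmall) (AffineProgression.A≡B⊎∣A+̂B∣≥ p p-prime A B q τ d d≢0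
    (subst (IsAP A τ d) ∣A∣≡2+q A-progression) (subst (λ n → n + ∣ B ∣ ≤ p) ∣A∣≡2+q ∣A∣+∣B∣≤p)
    (elemAt B (fromℕ< (≤-trans (s≤s z≤n) ∣B∣≥2)) , elemAt-∈ B _))
  where
  q = ∣ A ∣ ∸ 2
  ∣A∣≡2+q : ∣ A ∣ ≡ suc (suc q)
  ∣A∣≡2+q = sym (m+[n∸m]≡n (≤-trans (s≤s (s≤s z≤n)) ∣A∣≥5))
  ∣A+̂B∣-tooSmall : ¬ (q + ∣ B ∣ ≤ ∣ A +̂ B ∣)
  ∣A+̂B∣-tooSmall q+∣B∣≤ = <-irrefl refl (<-≤-trans (∸-monoʳ-< (s≤s z≤n) 1≤q+∣B∣)
    (≤-trans q+∣B∣≤ (≤-reflexive (trans ∣A+̂B∣≡ (cong (λ n → n + ∣ B ∣ ∸ 3) ∣A∣≡2+q)))))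
    where
    1≤q+∣B∣ : 1 ≤ q + ∣ B ∣
    1≤q+∣B∣ = ≤-trans (≤-trans (s≤s z≤n) ∣B∣≥2) (m≤n+m ∣ B ∣ q)
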